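{- Let $G$ be a connected triangle-free graph with no full star-cutset. Then $G$ has no cut-vertex of degree at least three. Moreover, if $G$ is not a path with at most $4$ vertices, then $G$ has minimum degree at least $2$.
   Context: A full star-cutset in a connected graph $G$ is a set $N[u]=\{u\}\cup N(u)$ whose removal disconnects $G$. -}

module Defs where

open import Data.Nat using (ℕ; suc; _≤_)
open import Data.Fin using (Fin; toℕ)
open import Data.List using (length)
open import Data.Product using (Σ; ∃; ∃-syntax; _×_; _,_)
open import Data.Sum using (_⊎_)
open import Relation.Nullary using (¬_; Dec)
open import Relation.Unary using (Pred; _∈_; _∉_)
open import Relation.Binary.PropositionalEquality using (_≡_; _≢_)
open import Function.Bundles using (Bijection)
open import Function.Bundles using (_⤖_)
open import Data.List.Base using (allFin) renaming (filter to filterL)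
open import Level using (0ℓ)

record Graph (n : ℕ) : Set₁ where
  field
    Adj     : Fin n → Fin n → Set
    adj?    : ∀ x y → Dec (Adj x y)
    sym     : ∀ {x y} → Adj x y → Adj y x
    irrefl  : ∀ {x} → ¬ Adj x x

module _ {n : ℕ} (G : Graph n) where
  open Graph G

  degree : Fin n → ℕ
  degree v = length (filterL (adj? v) (allFin n))

  -- walks in G all of whose vertices satisfy P (i.e. walks in the induced
  -- subgraph G[P])
  data WalkIn (P : Pred (Fin n) 0ℓ) : Fin n → Fin n → Set where
    here : ∀ {x} → P x → WalkIn P x x
    step : ∀ {x y z} → P x → Adj x y → WalkIn P y z → WalkIn P x z

  AllV : Pred (Fin n) 0ℓ
  AllV _ = Data.Unit.⊤
    where import Data.Unit

  Connected : Set
  Connected = ∀ x y → WalkIn AllV x y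

  Outside : Pred (Fin n) 0ℓ → Pred (Fin n) 0ℓ
  Outside S x = x ∉ S

  Disconnects : Pred (Fin n) 0ℓ → Set
  Disconnects S = ∃[ x ] ∃[ y ] (x ∉ S × y ∉ S × ¬ WalkIn (Outside S) x y)

  ClosedNbhd : Fin n → Pred (Fin n) 0ℓ
  ClosedNbhd u x = (x ≡ u) ⊎ Adj u x

  FullStarCutset : Fin n → Set
  FullStarCutset u = Disconnects (ClosedNbhd u)

  NoFullStarCutset : Set
  NoFullStarCutset = ∀ u → ¬ FullStarCutset u

  TriangleFree : Set
  TriangleFree = ∀ x y z → Adj x y → Adj y z → Adj x z → Data.Empty.⊥
    where import Data.Empty

  CutVertex : Fin n → Set
  CutVertex v = Disconnects (λ x → x ≡ v)

  MinDegreeAtLeast : ℕ → Set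
  MinDegreeAtLeast k = ∀ v → k ≤ degree v

PathAdj : ∀ {k} → Fin k → Fin k → Set
PathAdj i j = (toℕ j ≡ suc (toℕ i)) ⊎ (toℕ i ≡ suc (toℕ j))

IsPath : ∀ {n} → Graph n → Set
IsPath {n} G = Σ (Fin n ⤖ Fin n) λ f →
  ∀ x y → (Graph.Adj G x y → PathAdj (Bijection.to f x) (Bijection.to f y))
        × (PathAdj (Bijection.to f x) (Bijection.to f y) → Graph.Adj G x y)

module Submission where

-- If v is a cut-vertex, the two sides of G − v contain
-- neighbours a, b of v.  A third neighbour d of v is, by triangle-freeness,
-- outside both N[a] and N[b]; as neither is a cutset, d is joined to b
-- avoiding N[a] and to a avoiding N[b].  Such walks avoid v, so a and b are
-- joined in G − v: a contradiction.
--
-- A vertex v of degree 0 is all of G.  If v is a leaf with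
-- neighbour u, every other neighbour w of u dominates G − v (otherwise N[w]
-- separates v from a non-neighbour of w).  Following this, G is the induced
-- path v u, v u w or v u w y, so G is a path on at most 4 vertices.

open import Defs
open import Data.Nat using (ℕ; _≤_; zero; suc; z≤n; s≤s)
open import Data.Nat.Properties using (≤-refl; ≤-antisym; suc-injective)
open import Data.Fin using (Fin; zero; suc)
open import Data.Fin.Properties using (_≟_; any?; injective⇒≤)
open import Data.Vec.Functional using () renaming (_∷_ to _◂_)
open import Data.Product using (_×_; _,_; ∃-syntax; proj₁; proj₂)
open import Data.Sum using (_⊎_; inj₁; inj₂; [_,_])
open import Data.Empty using (⊥-elim)
open import Relation.Nullary using (¬_; yes; no)
open import Relation.Nullary.Decidable using (_×-dec_; ¬?)
open import Relation.Unary using (Pred)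
open import Relation.Binary.Definitions using (DecidableEquality)
open import Relation.Binary.PropositionalEquality
  using (_≡_; _≢_; refl; sym; trans; subst; subst₂; cong)
open import Data.List using (List; []; _∷_; length)
open import Data.List.Base using (allFin) renaming (filter to filterL)
open import Data.List.Membership.Propositional using (_∈_)
open import Data.List.Membership.Propositional.Properties using (∈-filter⁺; ∈-filter⁻; ∈-allFin)
open import Data.List.Relation.Unary.Any using (here; there)
open import Data.List.Relation.Unary.All using (_∷_) renaming (lookup to lookupAll)
open import Data.List.Relation.Unary.AllPairs using (_∷_)
open import Data.List.Relation.Unary.Unique.Propositional using (Unique)
import Data.List.Relation.Unary.Unique.Propositional.Properties as Unique
open import Function.Bundles using (mk↔ₛ′)
open import Function.Properties.Inverse using (↔⇒⤖)
open import Level using (0ℓ)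
open import Data.Unit using (⊤)

module _ {A : Set} where

  length0⇒∉ : ∀ {xs : List A} {y} → length xs ≡ 0 → ¬ y ∈ xs
  length0⇒∉ {[]} _ ()

  length1⇒singleton : ∀ {xs : List A} → length xs ≡ 1 →
    ∃[ u ] (u ∈ xs × (∀ {y} → y ∈ xs → y ≡ u))
  length1⇒singleton {u ∷ []} _ = u , here refl , λ { (here e) → e }

  module _ (_≟ᴬ_ : DecidableEquality A) where

    avoidOne : ∀ {xs : List A} → Unique xs → 2 ≤ length xs →
      ∀ q → ∃[ d ] (d ∈ xs × d ≢ q)
    avoidOne {b ∷ c ∷ _} ((b≢c ∷ _) ∷ _) (s≤s (s≤s _)) q with b ≟ᴬ q
    ... | yes refl = c , there (here refl) , λ c≡b → b≢c (sym c≡b)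
    ... | no b≢q   = b , here refl , b≢q

    avoidHeadAnd : ∀ {a} {xs : List A} → Unique (a ∷ xs) → 2 ≤ length xs →
      ∀ q → ∃[ d ] (d ∈ a ∷ xs × d ≢ q × d ≢ a)
    avoidHeadAnd (a∉xs ∷ uxs) len q with avoidOne uxs len q
    ... | d , d∈xs , d≢q = d , there d∈xs , d≢q , λ d≡a → lookupAll a∉xs d∈xs (sym d≡a)

    avoidTwo : ∀ {xs : List A} → Unique xs → 3 ≤ length xs →
      ∀ p q → ∃[ d ] (d ∈ xs × d ≢ p × d ≢ q)
    avoidTwo {a ∷ xs} u (s≤s len) p q with a ≟ᴬ p | a ≟ᴬ q
    ... | no a≢p   | no a≢q   = a , here refl , a≢p , a≢q
    ... | yes refl | _        = let (d , d∈ , d≢q , d≢a) = avoidHeadAnd u len q in d , d∈ , d≢a , d≢q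
    ... | no _     | yes refl = avoidHeadAnd u len p

module _ {n : ℕ} (G : Graph n) where
  open Graph G renaming (sym to adj-sym; irrefl to adj-irrefl)

  walkStart : ∀ {P x y} → WalkIn G P x y → P x
  walkStart (here p)     = p
  walkStart (step p _ _) = p

  walkMono : ∀ {P Q : Pred (Fin n) 0ℓ} {x y} → (∀ {z} → P z → Q z) →
    WalkIn G P x y → WalkIn G Q x y
  walkMono P⊆Q (here p)     = here (P⊆Q p)
  walkMono P⊆Q (step p a w) = step (P⊆Q p) a (walkMono P⊆Q w)

  walkTrans : ∀ {P x y z} → WalkIn G P x y → WalkIn G P y z → WalkIn G P x z
  walkTrans (here _)     w′ = w′
  walkTrans (step p a w) w′ = step p a (walkTrans w w′)

  walkSym : ∀ {P x y} → WalkIn G P x y → WalkIn G P y x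
  walkSym (here p)     = here p
  walkSym (step p a w) = walkTrans (walkSym w) (step (walkStart w) (adj-sym a) (here p))

  closedUnderWalks : ∀ {P : Pred (Fin n) 0ℓ} (S : Pred (Fin n) 0ℓ) →
    (∀ {a b} → S a → Adj a b → P b → S b) →
    ∀ {x y} → WalkIn G P x y → S x → S y
  closedUnderWalks S closed (here _)     sx = sx
  closedUnderWalks S closed (step _ a w) sx =
    closedUnderWalks S closed w (closed sx a (walkStart w))

  AllBut : Fin n → Pred (Fin n) 0ℓ
  AllBut v = Outside G (λ z → z ≡ v)

  lastStepInto : ∀ {x v} → WalkIn G (AllV G) x v → x ≢ v →
    ∃[ a ] (Adj v a × WalkIn G (AllBut v) x a)
  lastStepInto (here _) x≢v = ⊥-elim (x≢v refl)
  lastStepInto {x} {v} (step {y = m} _ a w) x≢v with m ≟ v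
  ... | yes refl = x , adj-sym a , here x≢v
  ... | no m≢v with lastStepInto w m≢v
  ...   | b , vb , wb = b , vb , step x≢v a wb

  starAvoidsCentre : ∀ {t v} → Adj t v → ∀ {z} → Outside G (ClosedNbhd G t) z → AllBut v z
  starAvoidsCentre tv z∉N[t] refl = z∉N[t] (inj₂ tv)

  notInStar : ∀ {t x} → x ≢ t → ¬ Adj t x → Outside G (ClosedNbhd G t) x
  notInStar x≢t _    (inj₁ x≡t) = x≢t x≡t
  notInStar _   ¬t~x (inj₂ t~x) = ¬t~x t~x

  neighbours : Fin n → List (Fin n)
  neighbours v = filterL (adj? v) (allFin n)

  adj⇒∈neighbours : ∀ {v y} → Adj v y → y ∈ neighbours v
  adj⇒∈neighbours {v} {y} a = ∈-filter⁺ (adj? v) (∈-allFin y) a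

  ∈neighbours⇒adj : ∀ {v y} → y ∈ neighbours v → Adj v y
  ∈neighbours⇒adj {v} m = proj₂ (∈-filter⁻ (adj? v) {xs = allFin n} m)

  neighboursUnique : ∀ v → Unique (neighbours v)
  neighboursUnique v = Unique.filter⁺ (adj? v) (Unique.allFin⁺ n)

  degree0⇒isolated : ∀ {v y} → degree G v ≡ 0 → ¬ Adj v y
  degree0⇒isolated {v} d0 a = length0⇒∉ {xs = neighbours v} d0 (adj⇒∈neighbours a)

  degree1⇒leaf : ∀ {v} → degree G v ≡ 1 → ∃[ u ] (Adj v u × (∀ {y} → Adj v y → y ≡ u))
  degree1⇒leaf {v} d1 with length1⇒singleton {xs = neighbours v} d1
  ... | u , u∈ , only = u , ∈neighbours⇒adj u∈ , λ a → only (adj⇒∈neighbours a)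

  degree3⇒thirdNeighbour : ∀ {v} → 3 ≤ degree G v → ∀ p q →
    ∃[ d ] (Adj v d × d ≢ p × d ≢ q)
  degree3⇒thirdNeighbour {v} d3 p q
    with avoidTwo _≟_ (neighboursUnique v) d3 p q
  ... | d , d∈ , d≢p , d≢q = d , ∈neighbours⇒adj d∈ , d≢p , d≢q

  record InducedPath {k : ℕ} (g : Fin k → Fin n) : Set where
    field
      injective : ∀ {i j} → g i ≡ g j → i ≡ j
      adj⇒path  : ∀ i j → Adj (g i) (g j) → PathAdj i j
      path⇒adj  : ∀ i j → PathAdj i j → Adj (g i) (g j)
  open InducedPath

  singletonPath : ∀ v → InducedPath {1} (λ _ → v)
  singletonPath v .injective {zero} {zero} _ = refl
  singletonPath v .adj⇒path zero zero a = ⊥-elim (adj-irrefl a)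
  singletonPath v .path⇒adj zero zero (inj₁ ())
  singletonPath v .path⇒adj zero zero (inj₂ ())

  prependPath : ∀ {k} {g : Fin (suc k) → Fin n} → InducedPath g → ∀ z →
    Adj z (g zero) → (∀ j → z ≢ g j) → (∀ j → ¬ Adj z (g (suc j))) →
    InducedPath (z ◂ g)
  prependPath P z z~g₀ new far = record { injective = inj ; adj⇒path = toPath ; path⇒adj = fromPath }
    where
    inj : ∀ {i j} → (z ◂ _) i ≡ (z ◂ _) j → i ≡ j
    inj {zero}  {zero}  _ = refl
    inj {zero}  {suc j} e = ⊥-elim (new j e)
    inj {suc i} {zero}  e = ⊥-elim (new i (sym e))
    inj {suc i} {suc j} e = cong suc (P .injective e)

    toPath : ∀ i j → Adj ((z ◂ _) i) ((z ◂ _) j) → PathAdj i j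
    toPath zero          zero          a = ⊥-elim (adj-irrefl a)
    toPath zero          (suc zero)    _ = inj₁ refl
    toPath zero          (suc (suc j)) a = ⊥-elim (far j a)
    toPath (suc zero)    zero          _ = inj₂ refl
    toPath (suc (suc i)) zero          a = ⊥-elim (far i (adj-sym a))
    toPath (suc i)       (suc j)       a =
      [ (λ e → inj₁ (cong suc e)) , (λ e → inj₂ (cong suc e)) ] (P .adj⇒path i j a)

    fromPath : ∀ i j → PathAdj i j → Adj ((z ◂ _) i) ((z ◂ _) j)
    fromPath zero          zero          (inj₁ ())
    fromPath zero          zero          (inj₂ ())
    fromPath zero          (suc zero)    _ = z~g₀
    fromPath zero          (suc (suc j)) (inj₁ ())
    fromPath zero          (suc (suc j)) (inj₂ ())
    fromPath (suc zero)    zero          _ = adj-sym z~g₀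
    fromPath (suc (suc i)) zero          (inj₁ ())
    fromPath (suc (suc i)) zero          (inj₂ ())
    fromPath (suc i)       (suc j)       p =
      P .path⇒adj i j ([ (λ e → inj₁ (suc-injective e)) , (λ e → inj₂ (suc-injective e)) ] p)

  Spanning : ∀ {k} → (Fin k → Fin n) → Set
  Spanning g = ∀ x → ∃[ i ] (g i ≡ x)

  spanningPath⇒isPath : ∀ {k} {g : Fin k → Fin n} → InducedPath g → Spanning g →
    IsPath G × n ≡ k
  spanningPath⇒isPath {k} {g} P span = relabel n≡k
    where
    index : Fin n → Fin k
    index x = proj₁ (span x)

    g∘index : ∀ x → g (index x) ≡ x
    g∘index x = proj₂ (span x)

    index∘g : ∀ i → index (g i) ≡ i
    index∘g i = P .injective (g∘index (g i))

    n≡k : n ≡ k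
    n≡k = ≤-antisym
      (injective⇒≤ λ {x} {y} e → trans (sym (g∘index x)) (trans (cong g e) (g∘index y)))
      (injective⇒≤ (P .injective))

    relabel : n ≡ k → IsPath G × n ≡ k
    relabel refl = (↔⇒⤖ (mk↔ₛ′ index g index∘g g∘index) , λ x y →
        (λ a → P .adj⇒path (index x) (index y)
                 (subst₂ Adj (sym (g∘index x)) (sym (g∘index y)) a))
      , (λ p → subst₂ Adj (g∘index x) (g∘index y) (P .path⇒adj _ _ p)))
      , refl

module StarCutsetFree {n : ℕ} (G : Graph n) (tf : TriangleFree G) (nf : NoFullStarCutset G) where
  open Graph G renaming (sym to adj-sym; irrefl to adj-irrefl)

  outsideSiblingStar : ∀ {v t x} → Adj v t → Adj v x → x ≢ t → Outside G (ClosedNbhd G t) x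
  outsideSiblingStar {v} {t} {x} vt vx x≢t =
    notInStar G x≢t (λ tx → tf t x v tx (adj-sym vx) (adj-sym vt))

  avoidStar⇒avoidCentre : ∀ {v t} → Adj v t → ∀ {p q} →
    WalkIn G (Outside G (ClosedNbhd G t)) p q → WalkIn G (AllBut G v) p q
  avoidStar⇒avoidCentre vt = walkMono G (starAvoidsCentre G (adj-sym vt))

  -- Two neighbours a, b of v sharing a third neighbour d of v cannot be
  -- separated by v: the walks d → b avoiding N[a] and d → a avoiding N[b]
  -- given by the absence of full star-cutsets both avoid v.
  neighboursLinked : ∀ {v a b d} → Adj v a → Adj v b → Adj v d → d ≢ a → d ≢ b →
    ¬ ¬ WalkIn G (AllBut G v) a b
  neighboursLinked {v} {a} {b} {d} va vb vd d≢a d≢b ¬a⇝b with a ≟ b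
  ... | yes refl = ¬a⇝b (here (λ a≡v → adj-irrefl (subst (Adj v) a≡v va)))
  ... | no a≢b =
    nf a (d , b , outsideSiblingStar va vd d≢a , outsideSiblingStar va vb (λ e → a≢b (sym e)) , λ d⇝b →
    nf b (d , a , outsideSiblingStar vb vd d≢b , outsideSiblingStar vb va a≢b , λ d⇝a →
    ¬a⇝b (walkTrans G (walkSym G (avoidStar⇒avoidCentre vb d⇝a)) (avoidStar⇒avoidCentre va d⇝b))))

  -- First half: a cut-vertex v has degree at most 2.  Its two sides contain
  -- neighbours a, b of v (last steps of walks into v), and a third
  -- neighbour would link a and b in G − v.
  cutVertexDegree≤2 : Connected G → ∀ v → CutVertex G v → ¬ (3 ≤ degree G v)
  cutVertexDegree≤2 conn v (x , y , x≢v , y≢v , ¬x⇝y) d3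
    with lastStepInto G (conn x v) x≢v | lastStepInto G (conn y v) y≢v
  ... | a , va , x⇝a | b , vb , y⇝b with degree3⇒thirdNeighbour G d3 a b
  ... | d , vd , d≢a , d≢b = neighboursLinked va vb vd d≢a d≢b λ a⇝b →
    ¬x⇝y (walkTrans G x⇝a (walkTrans G a⇝b (walkSym G y⇝b)))

  smallPath : ∀ {k} → k ≤ 4 → IsPath G × n ≡ k → IsPath G × n ≤ 4
  smallPath k≤4 (isPath , refl) = isPath , k≤4

  isolatedCase : Connected G → ∀ v → degree G v ≡ 0 → IsPath G × n ≤ 4
  isolatedCase conn v d0 =
    smallPath (s≤s z≤n) (spanningPath⇒isPath G (singletonPath G v) span)
    where
    span : Spanning G {1} (λ _ → v)
    span x = zero , sym (closedUnderWalks G (λ z → z ≡ v)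
                          (λ { refl a _ → ⊥-elim (degree0⇒isolated G d0 a) }) (conn v x) refl)

  module Leaf (v u : Fin n) (vu : Adj v u) (onlyU : ∀ {y} → Adj v y → y ≡ u) where

    v≢u : v ≢ u
    v≢u v≡u = adj-irrefl (subst (Adj v) (sym v≡u) vu)

    trapped : ∀ {P : Pred (Fin n) 0ℓ} → ¬ P u → ∀ {x} → WalkIn G P v x → x ≡ v
    trapped {P} ¬Pu v⇝x = closedUnderWalks G (λ z → z ≡ v)
      (λ { refl a Pb → ⊥-elim (¬Pu (subst P (onlyU a) Pb)) }) v⇝x refl

    -- Any other neighbour w of u is adjacent to every vertex except v and
    -- itself: otherwise N[w] ∋ u would separate v from a non-neighbour of w.
    dominates : ∀ {w} → Adj u w → w ≢ v → ∀ {x} → x ≢ v → x ≡ w ⊎ Adj w x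
    dominates {w} uw w≢v {x} x≢v with x ≟ w | adj? w x
    ... | yes x≡w | _       = inj₁ x≡w
    ... | no _    | yes w~x = inj₂ w~x
    ... | no x≢w  | no ¬w~x = ⊥-elim (nf w (v , x , v∉N[w] , notInStar G x≢w ¬w~x ,
          λ v⇝x → x≢v (trapped (λ u∉N[w] → u∉N[w] (inj₂ (adj-sym uw))) v⇝x)))
      where
      v∉N[w] : Outside G (ClosedNbhd G w) v
      v∉N[w] = notInStar G (λ v≡w → w≢v (sym v≡w))
                 (λ wv → adj-irrefl (subst (Adj u) (onlyU (adj-sym wv)) uw))

    pathOfTwo : Connected G → (∀ w → ¬ (Adj u w × w ≢ v)) → IsPath G × n ≤ 4
    pathOfTwo conn noW = smallPath (s≤s (s≤s z≤n)) (spanningPath⇒isPath G path span)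
      where
      path : InducedPath G (v ◂ λ _ → u)
      path = prependPath G (singletonPath G u) v vu (λ { zero → v≢u }) (λ ())

      edgeClosed : ∀ {a b} → a ≡ v ⊎ a ≡ u → Adj a b → ⊤ → b ≡ v ⊎ b ≡ u
      edgeClosed (inj₁ refl) vb _ = inj₂ (onlyU vb)
      edgeClosed {b = b} (inj₂ refl) ub _ with b ≟ v
      ... | yes b≡v = inj₁ b≡v
      ... | no b≢v  = ⊥-elim (noW b (ub , b≢v))

      span : Spanning G (v ◂ λ _ → u)
      span x with closedUnderWalks G _ edgeClosed (conn v x) (inj₁ refl)
      ... | inj₁ x≡v = zero , sym x≡v
      ... | inj₂ x≡u = suc zero , sym x≡u

    module SecondNeighbour (w : Fin n) (uw : Adj u w) (w≢v : w ≢ v) where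

      u≢w : u ≢ w
      u≢w u≡w = adj-irrefl (subst (Adj u) (sym u≡w) uw)

      ¬v~w : ¬ Adj v w
      ¬v~w vw = u≢w (sym (onlyU vw))

      v≢w : v ≢ w
      v≢w v≡w = w≢v (sym v≡w)

      pathUW : InducedPath G (u ◂ λ _ → w)
      pathUW = prependPath G (singletonPath G w) u uw (λ { zero → u≢w }) (λ ())

      pathVUW : InducedPath G (v ◂ u ◂ λ _ → w)
      pathVUW = prependPath G pathUW v vu (λ { zero → v≢u ; (suc zero) → v≢w }) (λ { zero → ¬v~w })

      pathOfThree : (∀ y → ¬ (Adj w y × y ≢ u)) → IsPath G × n ≤ 4
      pathOfThree noY = smallPath (s≤s (s≤s (s≤s z≤n))) (spanningPath⇒isPath G pathVUW span)
        where
        span : Spanning G (v ◂ u ◂ λ _ → w)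
        span x with x ≟ v
        ... | yes x≡v = zero , sym x≡v
        ... | no x≢v with dominates uw w≢v x≢v
        ...   | inj₁ x≡w = suc (suc zero) , sym x≡w
        ...   | inj₂ w~x with x ≟ u
        ...     | yes x≡u = suc zero , sym x≡u
        ...     | no x≢u  = ⊥-elim (noY x (w~x , x≢u))

      pathOfFour : ∀ y → Adj w y → y ≢ u → IsPath G × n ≤ 4
      pathOfFour y wy y≢u = smallPath ≤-refl (spanningPath⇒isPath G path span)
        where
        ¬u~y : ¬ Adj u y
        ¬u~y = tf u w y uw wy

        ¬v~y : ¬ Adj v y
        ¬v~y vy = y≢u (onlyU vy)

        w≢y : w ≢ y
        w≢y w≡y = adj-irrefl (subst (Adj w) (sym w≡y) wy)

        u≢y : u ≢ y
        u≢y u≡y = y≢u (sym u≡y)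

        v≢y : v ≢ y
        v≢y v≡y = ¬v~w (adj-sym (subst (Adj w) (sym v≡y) wy))

        path : InducedPath G (v ◂ u ◂ w ◂ λ _ → y)
        path = prependPath G
                 (prependPath G
                   (prependPath G (singletonPath G y) w wy (λ { zero → w≢y }) (λ ()))
                   u uw (λ { zero → u≢w ; (suc zero) → u≢y }) (λ { zero → ¬u~y }))
                 v vu (λ { zero → v≢u ; (suc zero) → v≢w ; (suc (suc zero)) → v≢y })
                 (λ { zero → ¬v~w ; (suc zero) → ¬v~y })

        -- Avoiding N[y], a walk from v stays in {v, u}: u's neighbours
        -- other than v are w ∈ N[y] or neighbours of w (a triangle).
        pairClosed : ∀ {a b} → a ≡ v ⊎ a ≡ u → Adj a b → Outside G (ClosedNbhd G y) b →
          b ≡ v ⊎ b ≡ u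
        pairClosed (inj₁ refl) vb _ = inj₂ (onlyU vb)
        pairClosed {b = b} (inj₂ refl) ub b∉N[y] with b ≟ v
        ... | yes b≡v = inj₁ b≡v
        ... | no b≢v with dominates uw w≢v b≢v
        ...   | inj₁ refl = ⊥-elim (b∉N[y] (inj₂ (adj-sym wy)))
        ...   | inj₂ wb   = ⊥-elim (tf u w b uw wb ub)

        span : Spanning G (v ◂ u ◂ w ◂ λ _ → y)
        span x with x ≟ v | x ≟ u | x ≟ w | x ≟ y
        ... | yes x≡v | _       | _       | _       = zero , sym x≡v
        ... | _       | yes x≡u | _       | _       = suc zero , sym x≡u
        ... | _       | _       | yes x≡w | _       = suc (suc zero) , sym x≡w
        ... | _       | _       | _       | yes x≡y = suc (suc (suc zero)) , sym x≡y
        ... | no x≢v  | no x≢u  | no x≢w  | no x≢y with dominates uw w≢v x≢v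
        ...   | inj₁ x≡w = ⊥-elim (x≢w x≡w)
        ...   | inj₂ wx  = ⊥-elim (nf y (v , x ,
                  notInStar G v≢y (λ yv → ¬v~y (adj-sym yv)) ,
                  outsideSiblingStar wy wx x≢y ,
                  λ v⇝x → [ x≢v , x≢u ] (closedUnderWalks G _ pairClosed v⇝x (inj₁ refl))))

    leafCase : Connected G → IsPath G × n ≤ 4
    leafCase conn with any? (λ w → adj? u w ×-dec ¬? (w ≟ v))
    ... | no noW = pathOfTwo conn (λ w p → noW (w , p))
    ... | yes (w , uw , w≢v) with any? (λ y → adj? w y ×-dec ¬? (y ≟ u))
    ...   | no noY = SecondNeighbour.pathOfThree w uw w≢v (λ y p → noY (y , p))
    ...   | yes (y , wy , y≢u) = SecondNeighbour.pathOfFour w uw w≢v y wy y≢u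

  minDegree≥2 : Connected G → ¬ (IsPath G × n ≤ 4) → MinDegreeAtLeast G 2
  minDegree≥2 conn notSmallPath v with degree G v in eq
  ... | zero        = ⊥-elim (notSmallPath (isolatedCase conn v eq))
  ... | suc zero    with degree1⇒leaf G eq
  ...   | u , vu , onlyU = ⊥-elim (notSmallPath (Leaf.leafCase v u vu onlyU conn))
  minDegree≥2 conn notSmallPath v | suc (suc _) = s≤s (s≤s z≤n)

mainTheorem19 : ∀ {n : ℕ} (G : Graph n) → Connected G → TriangleFree G → NoFullStarCutset G →
    (∀ v → CutVertex G v → ¬ (3 ≤ degree G v))
    × (¬ (IsPath G × n ≤ 4) → MinDegreeAtLeast G 2)
mainTheorem19 G conn tf nf =
  StarCutsetFree.cutVertexDegree≤2 G tf nf conn , StarCutsetFree.minDegree≥2 G tf nf conn
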